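{- Consider the bi-criteria algorithm $\mathcal{A}(\tilde F,\theta)$. Suppose a value $x$ arrives at time $t$, and its prefix maximum $y$ (the maximum value arriving before time $t$) arrives at time $s<t$. Then the algorithm accepts $x$ if and only if (1) $\tilde F(x) > \theta(t)$, (2) $x \ge y$, and (3) $\tilde F(y) \le \theta(s)$.
   Context: $\tilde F$ is a continuous distribution with full support on $[0,\infty)$ (identified with its cdf); realized values are almost surely distinct. Continuous-time model: each of the $n$ values $x_i$ has an independent arrival time $t_i$ uniform on $[0,1]$, and values arrive in order of arrival times. A threshold function is a non-increasing map $\theta:[0,1]\to[0,1]$. The prefix maximum for time $t$ is $\max_{i: t_i<t} x_i$ ($0$ if none); a value arriving at time $t$ is best-so-far if it is at least the prefix maximum for time $t$. The bi-criteria algorithm $\mathcal{A}(\tilde F,\theta)$: for each value $x_i$ arriving at time $t_i$ while nothing has been accepted, accept $x_i$ iff $x_i$ is best-so-far and $\tilde F(x_i) > \theta(t_i)$.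
   Formalization: The values $x_i$, the arrival times $t_i$, and the arguments and values of the cdf $\tilde F$ and of the threshold function $\theta$ are rational. -}

module Defs where

open import Data.Nat using (ℕ; zero; suc)
open import Data.Fin using (Fin)
open import Data.List using (foldr; allFin)
open import Data.Bool using (if_then_else_)
open import Data.Product using (_×_)
open import Data.Empty using (⊥)
open import Relation.Nullary using (¬_; does)
open import Data.Rational using (ℚ; 0ℚ; 1ℚ; _≤_; _<_; _⊔_)
open import Data.Rational.Properties using (_<?_)

-- An instance: n values x i arriving at times t i.
-- Prefix maximum for time τ: max of x j over arrivals with t j < τ (0 if none).
prefixMax : {n : ℕ} → (Fin n → ℚ) → (Fin n → ℚ) → ℚ → ℚ
prefixMax {n} x t τ =
  foldr (λ j m → if does (t j <? τ) then x j ⊔ m else m) 0ℚ (allFin n)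

BestSoFar : {n : ℕ} → (Fin n → ℚ) → (Fin n → ℚ) → Fin n → Set
BestSoFar x t i = prefixMax x t (t i) ≤ x i

Criterion : {n : ℕ} → (ℚ → ℚ) → (ℚ → ℚ) → (Fin n → ℚ) → (Fin n → ℚ) → Fin n → Set
Criterion F θ x t i = BestSoFar x t i × (θ (t i) < F (x i))

-- AcceptedF k i: value i is accepted, unfolded to recursion depth k:
-- i meets the criterion and no value arriving strictly earlier was accepted.
-- (Any chain of strictly earlier arrivals has length ≤ n, so depth n is exact.)
AcceptedF : {n : ℕ} → (ℚ → ℚ) → (ℚ → ℚ) → (Fin n → ℚ) → (Fin n → ℚ) → ℕ → Fin n → Set
AcceptedF F θ x t zero i = ⊥
AcceptedF F θ x t (suc k) i =
  Criterion F θ x t i × (∀ j → t j < t i → ¬ AcceptedF F θ x t k j)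

Accepts : {n : ℕ} → (ℚ → ℚ) → (ℚ → ℚ) → (Fin n → ℚ) → (Fin n → ℚ) → Fin n → Set
Accepts {n} F θ x t i = AcceptedF F θ x t n i

IsFullSupportCdf : (ℚ → ℚ) → Set
IsFullSupportCdf F =
  (∀ v → 0ℚ ≤ F v × F v ≤ 1ℚ) ×
  (∀ u v → u ≤ v → F u ≤ F v) ×
  (∀ u v → 0ℚ ≤ u → u < v → F u < F v)

IsThreshold : (ℚ → ℚ) → Set
IsThreshold θ =
  (∀ s → 0ℚ ≤ s → s ≤ 1ℚ → 0ℚ ≤ θ s × θ s ≤ 1ℚ) ×
  (∀ s s' → 0ℚ ≤ s → s ≤ s' → s' ≤ 1ℚ → θ s' ≤ θ s)

{-# OPTIONS --safe #-}
-- The earliest arrival meeting the acceptance criterion is always accepted, so being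
-- accepted means meeting the criterion while no earlier arrival does. With y the prefix
-- maximum at t, arriving at s, x is best-so-far iff x ≥ y; and no arrival before t meets
-- the criterion iff y does not: arrivals up to s are dominated by y both in F̃ and in θ,
-- while an arrival strictly between s and t could only be best-so-far by being y itself.
module Submission where

open import Defs
open import Data.Nat using (ℕ; zero; suc)
open import Data.Fin using (Fin; zero)
open import Data.Bool using (if_then_else_)
open import Data.List using (List; []; _∷_; foldr; allFin)
open import Data.List.Membership.Propositional using (_∈_)
open import Data.List.Membership.Propositional.Properties using (∈-allFin)
open import Data.List.Relation.Unary.Any using (here; there)
open import Data.Product using (_×_; _,_; proj₁; proj₂; ∃-syntax)
open import Data.Rational using (ℚ; 0ℚ; 1ℚ; _≤_; _<_; _⊔_)
open import Data.Rational.Properties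
open import Function.Bundles using (_⇔_; mk⇔; Equivalence)
open import Function.Definitions using (Injective)
open import Relation.Binary.PropositionalEquality using (_≡_; refl; sym; cong; subst)
open import Relation.Nullary using (¬_; Dec; does; yes; no; contradiction)
open import Relation.Nullary.Decidable using (_×-dec_)
open import Relation.Unary using (Pred; Decidable)

-- `with` cannot abstract over `t j <? τ` in these goals, since `does (t j <? τ)` reduces
-- further; so conditionals are eliminated by this lemma instead.
if-does : ∀ {a p q} {A : Set a} {P : Set p} (P? : Dec P) {u v : A} (Q : A → Set q) →
  (P → Q u) → (¬ P → Q v) → Q (if does P? then u else v)
if-does (yes p) _ onYes _ = onYes p
if-does (no ¬p) _ _ onNo = onNo ¬p

module _ {n : ℕ} (x t : Fin n → ℚ) where

  prefixMaxOver : List (Fin n) → ℚ → ℚ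
  prefixMaxOver L τ = foldr (λ j m → if does (t j <? τ) then x j ⊔ m else m) 0ℚ L

  prefixMaxOver-upper : ∀ {L j τ} → j ∈ L → t j < τ → x j ≤ prefixMaxOver L τ
  prefixMaxOver-upper {a ∷ _} {τ = τ} (here refl) ta<τ =
    if-does (t a <? τ) (x a ≤_) (λ _ → p≤p⊔q (x a) _) (contradiction ta<τ)
  prefixMaxOver-upper {a ∷ L} {j} {τ} (there j∈L) tj<τ =
    if-does (t a <? τ) (x j ≤_) (λ _ → p≤q⇒p≤r⊔q (x a) IH) (λ _ → IH)
    where
    IH : x j ≤ prefixMaxOver L τ
    IH = prefixMaxOver-upper j∈L tj<τ

  prefixMaxOver-mono : ∀ L {τ τ′} → τ ≤ τ′ → prefixMaxOver L τ ≤ prefixMaxOver L τ′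
  prefixMaxOver-mono [] _ = ≤-refl
  prefixMaxOver-mono (a ∷ L) {τ} {τ′} τ≤τ′ =
    if-does (t a <? τ) (_≤ prefixMaxOver (a ∷ L) τ′)
      (λ ta<τ → if-does (t a <? τ′) (x a ⊔ prefixMaxOver L τ ≤_)
        (λ _ → ⊔-monoʳ-≤ (x a) IH)
        (contradiction (<-≤-trans ta<τ τ≤τ′)))
      (λ _ → if-does (t a <? τ′) (prefixMaxOver L τ ≤_)
        (λ _ → p≤q⇒p≤r⊔q (x a) IH)
        (λ _ → IH))
    where
    IH : prefixMaxOver L τ ≤ prefixMaxOver L τ′
    IH = prefixMaxOver-mono L τ≤τ′

  prefixMax-upper : ∀ {j τ} → t j < τ → x j ≤ prefixMax x t τ
  prefixMax-upper {j} = prefixMaxOver-upper (∈-allFin j)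

  prefixMax-mono : ∀ {τ τ′} → τ ≤ τ′ → prefixMax x t τ ≤ prefixMax x t τ′
  prefixMax-mono = prefixMaxOver-mono (allFin n)

module _ {a p} {A : Set a} (key : A → ℚ) {P : Pred A p} (P? : Decidable P) where

  earliestIn : ∀ (L : List A) {c} → P c →
    ∃[ e ] (P e × key e ≤ key c × (∀ {j} → j ∈ L → key j < key e → ¬ P j))
  earliestIn [] {c} Pc = c , Pc , ≤-refl , λ ()
  earliestIn (a ∷ L) Pc with earliestIn L Pc
  ... | e , Pe , e≤c , minimal with P? a | key a <? key e
  ... | yes Pa | yes a<e = a , Pa , ≤-trans (<⇒≤ a<e) e≤c , λ
    { (here refl) j<j → contradiction j<j (<-irrefl refl)
    ; (there j∈L) j<a → minimal j∈L (<-trans j<a a<e) }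
  ... | yes _ | no a≮e = e , Pe , e≤c , λ
    { (here refl) a<e → contradiction a<e a≮e
    ; (there j∈L) → minimal j∈L }
  ... | no ¬Pa | _ = e , Pe , e≤c , λ
    { (here refl) _ → ¬Pa
    ; (there j∈L) → minimal j∈L }

module _ {n : ℕ} (F θ : ℚ → ℚ) (x t : Fin n → ℚ) where

  NoneMeetsCriterionBefore : ℚ → Set
  NoneMeetsCriterionBefore τ = ∀ j → t j < τ → ¬ Criterion F θ x t j

  criterion? : Decidable (Criterion F θ x t)
  criterion? i = (prefixMax x t (t i) ≤? x i) ×-dec (θ (t i) <? F (x i))

  acceptedF⇒criterion : ∀ {d j} → AcceptedF F θ x t d j → Criterion F θ x t j
  acceptedF⇒criterion {suc _} (meets , _) = meets

  criterion⇒earliest-acceptedF : ∀ d {c} → Criterion F θ x t c →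
    ∃[ e ] (t e ≤ t c × AcceptedF F θ x t (suc d) e)
  criterion⇒earliest-acceptedF d meets
    with earliestIn t criterion? (allFin n) meets
  ... | e , e-meets , te≤tc , minimal =
    e , te≤tc , (e-meets , λ j tj<te j-acc →
      minimal (∈-allFin j) tj<te (acceptedF⇒criterion j-acc))

  acceptedF⇔criterion×noneBefore : ∀ d {i} →
    AcceptedF F θ x t (suc (suc d)) i ⇔
    (Criterion F θ x t i × NoneMeetsCriterionBefore (t i))
  acceptedF⇔criterion×noneBefore d = mk⇔
    (λ (meets , noneAccepted) → meets , λ j tj<ti j-meets →
      let e , te≤tj , e-acc = criterion⇒earliest-acceptedF d j-meets
      in noneAccepted e (≤-<-trans te≤tj tj<ti) e-acc)
    (λ (meets , none) → meets , λ j tj<ti j-acc →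
      none j tj<ti (acceptedF⇒criterion j-acc))

  noneBefore⇔prefixMaxRejected :
    (∀ u v → u ≤ v → F u ≤ F v) →
    (∀ s s′ → 0ℚ ≤ s → s ≤ s′ → s′ ≤ 1ℚ → θ s′ ≤ θ s) →
    (∀ i → 0ℚ ≤ t i × t i ≤ 1ℚ) →
    Injective _≡_ _≡_ x →
    ∀ {k τ} → t k < τ → x k ≡ prefixMax x t τ →
    NoneMeetsCriterionBefore τ ⇔ (F (x k) ≤ θ (t k))
  noneBefore⇔prefixMaxRejected F-mono θ-anti t∈[0,1] x-inj {k} {τ} tk<τ xk≡max =
    mk⇔ rejected none
    where
    below-xk : ∀ {j} → t j < τ → x j ≤ x k
    below-xk tj<τ = subst (_ ≤_) (sym xk≡max) (prefixMax-upper x t tj<τ)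

    k-bestSoFar : BestSoFar x t k
    k-bestSoFar = subst (_ ≤_) (sym xk≡max) (prefixMax-mono x t (<⇒≤ tk<τ))

    rejected : NoneMeetsCriterionBefore τ → F (x k) ≤ θ (t k)
    rejected none = ≮⇒≥ (λ θtk<Fxk → none k tk<τ (k-bestSoFar , θtk<Fxk))

    none : F (x k) ≤ θ (t k) → NoneMeetsCriterionBefore τ
    none Fxk≤θtk j tj<τ (j-bestSoFar , θtj<Fxj) with t j ≤? t k
    ... | yes tj≤tk = <-irrefl refl (begin-strict
      θ (t j) <⟨ θtj<Fxj ⟩
      F (x j) ≤⟨ F-mono _ _ (below-xk tj<τ) ⟩
      F (x k) ≤⟨ Fxk≤θtk ⟩
      θ (t k) ≤⟨ θ-anti _ _ (proj₁ (t∈[0,1] j)) tj≤tk (proj₂ (t∈[0,1] k)) ⟩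
      θ (t j) ∎)
      where open ≤-Reasoning
    ... | no tj≰tk = tj≰tk (≤-reflexive (cong t j≡k))
      where
      tk<tj : t k < t j
      tk<tj = ≰⇒> tj≰tk

      j≡k : j ≡ k
      j≡k = x-inj (≤-antisym (below-xk tj<τ)
        (≤-trans (prefixMax-upper x t tk<tj) j-bestSoFar))

corollary9 : {n : ℕ} (F θ : ℚ → ℚ) (x t : Fin n → ℚ) →
    IsFullSupportCdf F → IsThreshold θ →
    (∀ i → 0ℚ ≤ x i) → (∀ i → 0ℚ ≤ t i × t i ≤ 1ℚ) →
    Injective _≡_ _≡_ x → Injective _≡_ _≡_ t →
    (i k : Fin n) → t k < t i → x k ≡ prefixMax x t (t i) →
    Accepts F θ x t i ⇔ ((θ (t i) < F (x i)) × (x k ≤ x i) × (F (x k) ≤ θ (t k)))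
corollary9 {suc zero} _ _ _ _ _ _ _ _ _ _ zero zero tk<tk _ = contradiction tk<tk (<-irrefl refl)
-- Only monotonicity of F̃ and θ and distinctness of the values are needed.
corollary9 {suc (suc d)} F θ x t (_ , F-mono , _) (_ , θ-anti) _ t∈[0,1] x-inj _ i k tk<ti xk≡max =
  mk⇔
    (λ accepted →
      let (bestSoFar , above) , none =
            Equivalence.to (acceptedF⇔criterion×noneBefore F θ x t d) accepted
      in above , subst (_≤ x i) (sym xk≡max) bestSoFar , Equivalence.to noneBefore⇔ none)
    (λ (above , xk≤xi , rejected) →
      Equivalence.from (acceptedF⇔criterion×noneBefore F θ x t d)
        ((subst (_≤ x i) xk≡max xk≤xi , above) , Equivalence.from noneBefore⇔ rejected))
  where
  noneBefore⇔ : NoneMeetsCriterionBefore F θ x t (t i) ⇔ (F (x k) ≤ θ (t k))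
  noneBefore⇔ = noneBefore⇔prefixMaxRejected F θ x t F-mono θ-anti t∈[0,1] x-inj tk<ti xk≡max
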